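{- Let $G=(V,w)$ be a weighted graph and let $Z\in\mathcal{M}(G)$ be a crossless non-star minimum cut with shores $X_0$ and $X_1=V\setminus X_0$. For $b\in\{0,1\}$ let $\mathcal{M}_b=\{S\in\mathcal{M}(G): S\subseteq Z\cup E(X_b)\}$. Let $\{G_0,G_1\}$ be the separation of $G$ along $Z$. Then $\dim\mathrm{span}\{\chi(S):S\in\mathcal{M}_b\}=\mathrm{cdim}(G_b)$ for $b\in\{0,1\}$.
   Context: $G=(V,w)$ has nonnegative weights on unordered pairs of distinct vertices; its edge set $E$ is the set of pairs of positive weight. For $\emptyset\ne X\subsetneq V$, $\Delta(X)$ is the set of edges with exactly one endpoint in $X$ (shores $X$, $V\setminus X$), weight the sum of its edge weights. $\mathcal{M}(G)$ is the set of minimum-weight cuts; for $S\subseteq E$, $\chi(S)\in\{0,1\}^{|E|}$ is its characteristic vector among the edges of $G$; $\mathrm{cdim}(G)=\dim\mathrm{span}\{\chi(S):S\in\mathcal{M}(G)\}$. $E(X)$ denotes the edges with both endpoints in $X$. A cut is non-star if both shores have at least two vertices. Sets $X,Y$ cross if $X\cap Y$, $X\setminus Y$, $Y\setminus X$, $V\setminus(X\cup Y)$ are nonempty; a minimum cut is crossless if no other minimum cut crosses it. Separation of $G$ along the cut $Z$ with shores $X_0,X_1$: for $b\in\{0,1\}$, $G_b=(V_b,w_b)$ with $V_b=X_b\cup\{v_{1-b}\}$ for new vertices $v_0,v_1$, $w_b(\{x,y\})=w(\{x,y\})$ for $x,y\in X_b$, and $w_b(\{x,v_{1-b}\})=\sum_{y\in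 X_{1-b}}w(\{x,y\})$ for $x\in X_b$.
   Formalization: The edge weights of G take values in the nonnegative rationals instead of the reals, and the spans of characteristic vectors are taken over ℚ. -}

module Defs where

open import Data.Nat using (ℕ; zero; suc)
open import Data.Fin using (Fin; zero; suc)
open import Data.Bool using (Bool; true; false; _xor_; _∧_; not; if_then_else_; T)
open import Data.Rational using (ℚ; 0ℚ; 1ℚ; _+_; _*_; _≤_; _<_)
open import Data.Rational.Properties using (_<?_)
open import Data.Product using (Σ; ∃; _×_; _,_)
open import Data.Sum using (_⊎_; inj₁; inj₂)
open import Data.Unit using (⊤; tt)
open import Relation.Binary.PropositionalEquality using (_≡_; _≢_)
open import Relation.Nullary using (¬_)
open import Relation.Nullary.Decidable using (⌊_⌋)
open import Function.Bundles using (_↔_; Inverse)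

sumF : ∀ {n} → (Fin n → ℚ) → ℚ
sumF {zero} f = 0ℚ
sumF {suc n} f = f zero + sumF (λ i → f (suc i))

-- A weighted graph on vertex set V = Fin n: w i j is the weight of the
-- unordered pair {i,j} (i ≢ j); the diagonal is never used.
Weight : ℕ → Set
Weight n = Fin n → Fin n → ℚ

IsWeightedGraph : ∀ {n} → Weight n → Set
IsWeightedGraph {n} w = (∀ (i j : Fin n) → w i j ≡ w j i)
                      × (∀ (i j : Fin n) → i ≢ j → 0ℚ ≤ w i j)

Subset : ℕ → Set
Subset n = Fin n → Bool

Proper : ∀ {n} → Subset n → Set
Proper X = (∃ λ i → X i ≡ true) × (∃ λ j → X j ≡ false)

IsEdge : ∀ {n} → Weight n → Fin n → Fin n → Set
IsEdge w i j = (i ≢ j) × (0ℚ < w i j)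

Separates : ∀ {n} → Subset n → Fin n → Fin n → Set
Separates X i j = X i xor X j ≡ true

-- weight of Δ(X): each unordered pair with one end in X counted once
cutWeight : ∀ {n} → Weight n → Subset n → ℚ
cutWeight w X = sumF (λ i → sumF (λ j →
  if X i ∧ not (X j) then w i j else 0ℚ))

IsMinCut : ∀ {n} → Weight n → Subset n → Set
IsMinCut {n} w X = Proper X × (∀ (Y : Subset n) → Proper Y → cutWeight w X ≤ cutWeight w Y)

-- vectors indexed by (ordered) pairs of vertices; coordinates (i,j) and (j,i)
-- agree for characteristic vectors, and coordinates of non-edges are 0
Vect : ℕ → Set
Vect n = Fin n → Fin n → ℚ

chi : ∀ {n} → Weight n → Subset n → Vect n
chi w X i j = if (X i xor X j) ∧ ⌊ 0ℚ <? w i j ⌋ then 1ℚ else 0ℚ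

LinIndep : ∀ {n d} → (Fin d → Vect n) → Set
LinIndep {n} {d} f = ∀ (c : Fin d → ℚ) →
  (∀ (i j : Fin n) → sumF (λ k → c k * f k i j) ≡ 0ℚ) → ∀ k → c k ≡ 0ℚ

HasDimSpan : ∀ {n} → (Vect n → Set) → ℕ → Set
HasDimSpan {n} P d =
  (∃ λ (f : Fin d → Vect n) → (∀ k → P (f k)) × LinIndep f)
  × (∀ (g : Fin (suc d) → Vect n) → (∀ k → P (g k)) → ¬ LinIndep g)

MinCutVec : ∀ {n} → Weight n → Vect n → Set
MinCutVec {n} w v = ∃ λ (X : Subset n) → IsMinCut w X × (∀ i j → v i j ≡ chi w X i j)

CdimIs : ∀ {n} → Weight n → ℕ → Set
CdimIs w d = HasDimSpan (MinCutVec w) d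

Cross : ∀ {n} → Subset n → Subset n → Set
Cross X Y = (∃ λ i → X i ≡ true × Y i ≡ true)
          × (∃ λ i → X i ≡ true × Y i ≡ false)
          × (∃ λ i → X i ≡ false × Y i ≡ true)
          × (∃ λ i → X i ≡ false × Y i ≡ false)

Crossless : ∀ {n} → Weight n → Subset n → Set
Crossless {n} w X = ∀ (Y : Subset n) → IsMinCut w Y → ¬ Cross X Y

NonStar : ∀ {n} → Subset n → Set
NonStar X = (∃ λ i → ∃ λ j → i ≢ j × X i ≡ false × X j ≡ false)
          × (∃ λ i → ∃ λ j → i ≢ j × X i ≡ true × X j ≡ true)

-- Shores: X_b = { i | s i ≡ b }, with b = false for X_0, b = true for X_1.
-- M_b = { S ∈ M(G) : S ⊆ Z ∪ E(X_b) }, Z = Δ(X_0); its characteristic vectors: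
MbVec : ∀ {n} → Weight n → Subset n → Bool → Vect n → Set
MbVec {n} w s b v = ∃ λ (X : Subset n) → IsMinCut w X
  × (∀ (i j : Fin n) → IsEdge w i j → Separates X i j →
       Separates s i j ⊎ (s i ≡ b × s j ≡ b))
  × (∀ i j → v i j ≡ chi w X i j)

-- vertex set of G_b: X_b together with one new vertex v_{1-b}
SepVertex : ∀ {n} → Subset n → Bool → Set
SepVertex {n} s b = (Σ (Fin n) (λ i → s i ≡ b)) ⊎ ⊤

sepWeight : ∀ {n} (w : Weight n) (s : Subset n) (b : Bool) →
            SepVertex s b → SepVertex s b → ℚ
sepWeight w s b (inj₁ (x , _)) (inj₁ (y , _)) = w x y
sepWeight w s b (inj₁ (x , _)) (inj₂ _) =
  sumF (λ y → if s y xor b then w x y else 0ℚ)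
sepWeight w s b (inj₂ _) (inj₁ (y , _)) =
  sumF (λ x → if s x xor b then w x y else 0ℚ)
sepWeight w s b (inj₂ _) (inj₂ _) = 0ℚ

sepGraph : ∀ {n m} (w : Weight n) (s : Subset n) (b : Bool) →
           Fin m ↔ SepVertex s b → Weight m
sepGraph w s b φ i j = sepWeight w s b (Inverse.to φ i) (Inverse.to φ j)

-- A cut U of G_b lifts to the cut of G that puts all of X_{1-b} on the side of v_{1-b}; lifting
-- preserves the cut weight, so the lifts of the minimum cuts of G_b are exactly the cuts of M_b
-- that do not split X_{1-b}. A cut X of M_b that does split X_{1-b} is constant on X_b because Z
-- is crossless; then X and the part Y of X_{1-b} lying on X_b's side together weigh at most w(Z),
-- so the minimum cut weight is 0 and all the characteristic vectors involved vanish. In both directions every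
-- entry of a characteristic vector is 0 or an entry of the corresponding vector in the other graph
-- (the pair {x, v_{1-b}} is an edge of G_b iff x has an edge into X_{1-b}), so linear independence
-- transfers both ways and the two spans have the same dimension. That dimension exists because
-- there are finitely many cuts and linear independence over ℚ is decidable by Gaussian elimination.

module Submission where

open import Defs
open import Algebra.Bundles using (CommutativeRing)
open import Data.Nat as ℕ using (ℕ; zero; suc; z≤n; s≤s; _^_)
import Data.Nat.Properties as ℕ
open import Data.Fin using (Fin; zero; suc; punchIn; finToFun; funToFin)
open import Data.Fin.Properties using (punchInᵢ≢i; any?; all?; ¬∀⟶∃¬; 2↔Bool; finToFun-funToFin)
  renaming (_≟_ to _≟ᶠ_)
open import Data.Bool using (Bool; true; false; _xor_; _∧_; not; if_then_else_)
open import Data.Bool.Properties using (∧-zeroʳ; xor-same; xor-inverseˡ; ¬-not; not-¬) renaming (_≟_ to _≟ᵇ_)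
open import Data.Rational hiding (floor)
open import Data.Rational.Properties
open import Data.Rational.Solver using (module +-*-Solver)
open import Data.Product
open import Data.Sum using (_⊎_; inj₁; inj₂)
open import Data.Unit using (tt)
open import Data.Empty using (⊥-elim)
open import Axiom.UniquenessOfIdentityProofs using (module Decidable⇒UIP)
open import Data.Maybe using (Maybe; just; nothing)
open import Data.List using (List; []; _∷_; length; allFin; cartesianProduct)
open import Data.List.Membership.Propositional using (_∈_)
open import Data.List.Membership.Propositional.Properties using (∈-allFin; ∈-cartesianProduct⁺)
open import Data.List.Relation.Unary.Any using (here; there)
open import Data.Vec.Functional using (insertAt; removeAt)
open import Data.Vec.Functional.Properties
  using (insertAt-lookup; insertAt-punchIn; removeAt-insertAt; insertAt-removeAt; removeAt-punchOut)
open import Function.Base using (_∘_; case_of_)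
open import Function.Bundles using (_↔_; Inverse)
open import Relation.Binary.PropositionalEquality
open import Relation.Nullary
open import Relation.Nullary.Decidable using (⌊_⌋; _×-dec_; _⊎-dec_; _→-dec_; map′; decidable-stable)
import Algebra.Properties.Semiring.Sum as SemiringSum

open ≡-Reasoning

module ∑ = SemiringSum (CommutativeRing.semiring +-*-commutativeRing)

sumF≡sum : ∀ {n} (f : Fin n → ℚ) → sumF f ≡ ∑.sum f
sumF≡sum {zero}  f = refl
sumF≡sum {suc n} f = cong (f zero +_) (sumF≡sum (λ i → f (suc i)))

sumF-cong : ∀ {n} {f g : Fin n → ℚ} → (∀ i → f i ≡ g i) → sumF f ≡ sumF g
sumF-cong {f = f} {g} f≗g = begin
  sumF f   ≡⟨ sumF≡sum f ⟩
  ∑.sum f  ≡⟨ ∑.sum-cong-≗ f≗g ⟩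
  ∑.sum g  ≡⟨ sumF≡sum g ⟨
  sumF g   ∎

sumF-zero : ∀ {n} {f : Fin n → ℚ} → (∀ i → f i ≡ 0ℚ) → sumF f ≡ 0ℚ
sumF-zero {n} f≗0 = trans (sumF-cong f≗0) (trans (sumF≡sum {n} (λ _ → 0ℚ)) (∑.sum-replicate-zero n))

sumF-+ : ∀ {n} (f g : Fin n → ℚ) → sumF (λ i → f i + g i) ≡ sumF f + sumF g
sumF-+ f g = begin
  sumF (λ i → f i + g i)   ≡⟨ sumF≡sum (λ i → f i + g i) ⟩
  ∑.sum (λ i → f i + g i)  ≡⟨ ∑.∑-distrib-+ f g ⟩
  ∑.sum f + ∑.sum g        ≡⟨ cong₂ _+_ (sumF≡sum f) (sumF≡sum g) ⟨
  sumF f + sumF g          ∎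

sumF-*ˡ : ∀ {n} (a : ℚ) (f : Fin n → ℚ) → sumF (λ i → a * f i) ≡ a * sumF f
sumF-*ˡ a f = begin
  sumF (λ i → a * f i)   ≡⟨ sumF≡sum (λ i → a * f i) ⟩
  ∑.sum (λ i → a * f i)  ≡⟨ ∑.*-distribˡ-sum a f ⟨
  a * ∑.sum f            ≡⟨ cong (a *_) (sumF≡sum f) ⟨
  a * sumF f             ∎

sumF-comm : ∀ {n m} (f : Fin n → Fin m → ℚ) →
            sumF (λ i → sumF (f i)) ≡ sumF (λ j → sumF (λ i → f i j))
sumF-comm f = begin
  sumF (λ i → sumF (f i))                ≡⟨ sumF-cong (λ i → sumF≡sum (f i)) ⟩
  sumF (λ i → ∑.sum (f i))               ≡⟨ sumF≡sum (λ i → ∑.sum (f i)) ⟩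
  ∑.sum (λ i → ∑.sum (f i))              ≡⟨ ∑.∑-comm f ⟩
  ∑.sum (λ j → ∑.sum (λ i → f i j))      ≡⟨ sumF≡sum (λ j → ∑.sum (λ i → f i j)) ⟨
  sumF (λ j → ∑.sum (λ i → f i j))       ≡⟨ sumF-cong (λ j → sumF≡sum (λ i → f i j)) ⟨
  sumF (λ j → sumF (λ i → f i j))        ∎

sumF-remove : ∀ {n} (p : Fin (suc n)) (f : Fin (suc n) → ℚ) →
              sumF f ≡ f p + sumF (λ j → f (punchIn p j))
sumF-remove p f = begin
  sumF f                               ≡⟨ sumF≡sum f ⟩
  ∑.sum f                              ≡⟨ ∑.sum-remove {i = p} f ⟩
  f p + ∑.sum (λ j → f (punchIn p j))  ≡⟨ cong (f p +_) (sumF≡sum (λ j → f (punchIn p j))) ⟨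
  f p + sumF (λ j → f (punchIn p j))   ∎

sumF-single : ∀ {n} (p : Fin n) (f : Fin n → ℚ) → (∀ i → i ≢ p → f i ≡ 0ℚ) → sumF f ≡ f p
sumF-single {suc n} p f off = begin
  sumF f                              ≡⟨ sumF-remove p f ⟩
  f p + sumF (λ j → f (punchIn p j))  ≡⟨ cong (f p +_) (sumF-zero (λ j → off _ (punchInᵢ≢i p j))) ⟩
  f p + 0ℚ                            ≡⟨ +-identityʳ (f p) ⟩
  f p                                 ∎

sumF-mono-≤ : ∀ {n} {f g : Fin n → ℚ} → (∀ i → f i ≤ g i) → sumF f ≤ sumF g
sumF-mono-≤ {zero}  f≤g = ≤-refl
sumF-mono-≤ {suc n} f≤g = +-mono-≤ (f≤g zero) (sumF-mono-≤ (λ i → f≤g (suc i)))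

sumF-nonNeg : ∀ {n} {f : Fin n → ℚ} → (∀ i → 0ℚ ≤ f i) → 0ℚ ≤ sumF f
sumF-nonNeg {n} 0≤f = ≤-trans (≤-reflexive (sym (sumF-zero {n} (λ _ → refl)))) (sumF-mono-≤ 0≤f)

sumF-nonPos : ∀ {n} {f : Fin n → ℚ} → (∀ i → f i ≤ 0ℚ) → sumF f ≤ 0ℚ
sumF-nonPos {n} f≤0 = ≤-trans (sumF-mono-≤ f≤0) (≤-reflexive (sumF-zero {n} (λ _ → refl)))

≤-sumF : ∀ {n} {f : Fin n → ℚ} → (∀ i → 0ℚ ≤ f i) → ∀ p → f p ≤ sumF f
≤-sumF {suc n} {f} 0≤f p = ≤-trans (≤-reflexive (sym (+-identityʳ (f p))))
  (≤-trans (+-monoʳ-≤ (f p) (sumF-nonNeg (λ j → 0≤f (punchIn p j))))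
           (≤-reflexive (sym (sumF-remove p f))))

-- Linear independence by Gaussian elimination

module _ {C : Set} where

  combination : ∀ {k} → (Fin k → ℚ) → (Fin k → C → ℚ) → C → ℚ
  combination c f y = sumF (λ i → c i * f i y)

  IndependentOn : List C → ∀ {k} → (Fin k → C → ℚ) → Set
  IndependentOn cs {k} f =
    ∀ (c : Fin k → ℚ) → (∀ y → y ∈ cs → combination c f y ≡ 0ℚ) → ∀ i → c i ≡ 0ℚ

  combination-congˡ : ∀ {k} {c c′ : Fin k → ℚ} (f : Fin k → C → ℚ) y →
                      (∀ i → c i ≡ c′ i) → combination c f y ≡ combination c′ f y
  combination-congˡ f y c≗c′ = sumF-cong (λ i → cong (_* f i y) (c≗c′ i))

  combination-zeroˡ : ∀ {k} {c : Fin k → ℚ} (f : Fin k → C → ℚ) y →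
                      (∀ i → c i ≡ 0ℚ) → combination c f y ≡ 0ℚ
  combination-zeroˡ f y c≗0 = sumF-zero (λ i → trans (cong (_* f i y) (c≗0 i)) (*-zeroˡ (f i y)))

  combination-zeroʳ : ∀ {k} (c : Fin k → ℚ) (f : Fin k → C → ℚ) y →
                      (∀ i → f i y ≡ 0ℚ) → combination c f y ≡ 0ℚ
  combination-zeroʳ c f y f≗0 = sumF-zero (λ i → trans (cong (c i *_) (f≗0 i)) (*-zeroʳ (c i)))

  combination-removeAt : ∀ {k} (c : Fin (suc k) → ℚ) (f : Fin (suc k) → C → ℚ) p y →
    combination c f y ≡ c p * f p y + combination (removeAt c p) (removeAt f p) y
  combination-removeAt c f p y = sumF-remove p (λ i → c i * f i y)

  independentOn-∷ : ∀ {k} (f : Fin k → C → ℚ) x cs → IndependentOn cs f → IndependentOn (x ∷ cs) f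
  independentOn-∷ f x cs ind c vanish = ind c (λ y y∈cs → vanish y (there y∈cs))

  independentOn-∷⁻ : ∀ {k} (f : Fin k → C → ℚ) x cs → (∀ i → f i x ≡ 0ℚ) →
                     IndependentOn (x ∷ cs) f → IndependentOn cs f
  independentOn-∷⁻ f x cs column≗0 ind c vanish = ind c λ where
    y (here refl)    → combination-zeroʳ c f x column≗0
    y (there y∈cs)  → vanish y y∈cs

  ¬independentOn-[] : ∀ {k} (f : Fin (suc k) → C → ℚ) → ¬ IndependentOn [] f
  ¬independentOn-[] f ind = 1≢0 (ind (λ _ → 1ℚ) (λ _ ()) zero)

  module Elimination {k} (f : Fin (suc k) → C → ℚ) (p : Fin (suc k)) (x : C)
                     (f[p,x]≢0 : f p x ≢ 0ℚ) where

    private instance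
      f[p,x]-nonZero : NonZero (f p x)
      f[p,x]-nonZero = ≢-nonZero f[p,x]≢0

    r : ℚ
    r = 1/ f p x

    reduced : Fin k → C → ℚ
    reduced j y = f (punchIn p j) y - (f (punchIn p j) x * r) * f p y

    pivotCoefficient : (Fin k → ℚ) → ℚ
    pivotCoefficient c = - (combination c (removeAt f p) x * r)

    reduced-pivotColumn : ∀ j → reduced j x ≡ 0ℚ
    reduced-pivotColumn j = begin
      a - (a * r) * f p x   ≡⟨ cong (λ t → a - t) (trans (*-assoc a r (f p x)) (cong (a *_) (*-inverseˡ (f p x)))) ⟩
      a - a * 1ℚ            ≡⟨ cong (λ t → a - t) (*-identityʳ a) ⟩
      a - a                 ≡⟨ +-inverseʳ a ⟩
      0ℚ                    ∎
      where a = f (punchIn p j) x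

    combination-reduced : ∀ c y →
      combination c reduced y ≡ combination (insertAt c p (pivotCoefficient c)) f y
    combination-reduced c y = begin
      sumF (λ j → c j * reduced j y)
        ≡⟨ sumF-cong (λ j → expand (c j) (f (punchIn p j) y) (f (punchIn p j) x) r (f p y)) ⟩
      sumF (λ j → c j * f (punchIn p j) y + - (r * f p y) * (c j * f (punchIn p j) x))
        ≡⟨ sumF-+ (λ j → c j * f (punchIn p j) y) (λ j → - (r * f p y) * (c j * f (punchIn p j) x)) ⟩
      Sy + sumF (λ j → - (r * f p y) * (c j * f (punchIn p j) x))
        ≡⟨ cong (Sy +_) (sumF-*ˡ (- (r * f p y)) (λ j → c j * f (punchIn p j) x)) ⟩
      Sy + - (r * f p y) * Sx
        ≡⟨ collect Sy Sx r (f p y) ⟩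
      pivotCoefficient c * f p y + Sy
        ≡⟨ cong₂ (λ u v → u * f p y + v) (insertAt-lookup c p _)
                 (combination-congˡ (removeAt f p) y (removeAt-insertAt c p _)) ⟨
      c⁺ p * f p y + combination (removeAt c⁺ p) (removeAt f p) y
        ≡⟨ combination-removeAt c⁺ f p y ⟨
      combination c⁺ f y ∎
      where
      open +-*-Solver
      c⁺ = insertAt c p (pivotCoefficient c)
      Sy = combination c (removeAt f p) y
      Sx = combination c (removeAt f p) x
      expand : ∀ u a b r F → u * (a - (b * r) * F) ≡ u * a + - (r * F) * (u * b)
      expand = solve 5 (λ u a b r F → u :* (a :- (b :* r) :* F) := u :* a :+ :- (r :* F) :* (u :* b)) refl
      collect : ∀ Sy Sx r F → Sy + - (r * F) * Sx ≡ - (Sx * r) * F + Sy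
      collect = solve 4 (λ Sy Sx r F → Sy :+ :- (r :* F) :* Sx := :- (Sx :* r) :* F :+ Sy) refl

    pivotCoefficient-removeAt : ∀ c → combination c f x ≡ 0ℚ → pivotCoefficient (removeAt c p) ≡ c p
    pivotCoefficient-removeAt c vanish = begin
      - (S * r)                                   ≡⟨ rearrange (c p) (f p x) S r ⟩
      c p * (f p x * r) - (c p * f p x + S) * r   ≡⟨ cong₂ (λ u v → c p * u - v * r) (*-inverseʳ (f p x))
                                                          (trans (sym (combination-removeAt c f p x)) vanish) ⟩
      c p * 1ℚ - 0ℚ * r                           ≡⟨ cleanup (c p) r ⟩
      c p                                         ∎
      where
      open +-*-Solver
      S = combination (removeAt c p) (removeAt f p) x
      rearrange : ∀ cp a S r → - (S * r) ≡ cp * (a * r) - (cp * a + S) * r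
      rearrange = solve 4 (λ cp a S r → :- (S :* r) := cp :* (a :* r) :- (cp :* a :+ S) :* r) refl
      cleanup : ∀ cp r → cp * 1ℚ - 0ℚ * r ≡ cp
      cleanup = solve 2 (λ cp r → cp :* con 1ℚ :- con 0ℚ :* r := cp) refl

    independentOn-reduced : ∀ cs → IndependentOn (x ∷ cs) f → IndependentOn cs reduced
    independentOn-reduced cs ind c vanish j = begin
      c j                   ≡⟨ insertAt-punchIn c p _ j ⟨
      c⁺ (punchIn p j)      ≡⟨ c⁺≗0 (punchIn p j) ⟩
      0ℚ                    ∎
      where
      c⁺ = insertAt c p (pivotCoefficient c)
      c⁺≗0 = ind c⁺ λ where
        y (here refl)   → trans (sym (combination-reduced c x)) (combination-zeroʳ c reduced x reduced-pivotColumn)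
        y (there y∈cs) → trans (sym (combination-reduced c y)) (vanish y y∈cs)

    independentOn-reduced⁻ : ∀ cs → IndependentOn cs reduced → IndependentOn (x ∷ cs) f
    independentOn-reduced⁻ cs ind c vanish = c≗0
      where
      c[p]≡pivot : pivotCoefficient (removeAt c p) ≡ c p
      c[p]≡pivot = pivotCoefficient-removeAt c (vanish x (here refl))

      restored : ∀ y → combination (removeAt c p) reduced y ≡ combination c f y
      restored y = trans (combination-reduced (removeAt c p) y) (combination-congˡ f y λ i →
        trans (cong (λ v → insertAt (removeAt c p) p v i) c[p]≡pivot) (insertAt-removeAt c p i))

      rest≗0 : ∀ j → removeAt c p j ≡ 0ℚ
      rest≗0 = ind (removeAt c p) (λ y y∈cs → trans (restored y) (vanish y (there y∈cs)))

      c[p]≡0 : c p ≡ 0ℚ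
      c[p]≡0 = begin
        c p                                                  ≡⟨ c[p]≡pivot ⟨
        - (combination (removeAt c p) (removeAt f p) x * r)
          ≡⟨ cong (λ t → - (t * r)) (combination-zeroˡ (removeAt f p) x rest≗0) ⟩
        - (0ℚ * r)                                           ≡⟨ cong -_ (*-zeroˡ r) ⟩
        0ℚ                                                   ∎

      c≗0 : ∀ i → c i ≡ 0ℚ
      c≗0 i with i ≟ᶠ p
      ... | yes refl = c[p]≡0
      ... | no i≢p   = trans (sym (removeAt-punchOut c (i≢p ∘ sym))) (rest≗0 _)

  pivot? : ∀ {k} (f : Fin k → C → ℚ) x → (∃ λ p → f p x ≢ 0ℚ) ⊎ (∀ i → f i x ≡ 0ℚ)
  pivot? f x with any? (λ i → ¬? (f i x ≟ 0ℚ))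
  ... | yes pivot = inj₁ pivot
  ... | no ¬pivot = inj₂ (λ i → decidable-stable (f i x ≟ 0ℚ) (λ f[i,x]≢0 → ¬pivot (i , f[i,x]≢0)))

  independentOn? : ∀ cs {k} (f : Fin k → C → ℚ) → Dec (IndependentOn cs f)
  independentOn? []       {zero}  f = yes (λ _ _ ())
  independentOn? []       {suc k} f = no (¬independentOn-[] f)
  independentOn? (x ∷ cs)         f with pivot? f x
  ... | inj₂ column≗0 = map′ (independentOn-∷ f x cs) (independentOn-∷⁻ f x cs column≗0) (independentOn? cs f)
  independentOn? (x ∷ cs) {suc k} f | inj₁ (p , f[p,x]≢0) =
    map′ (independentOn-reduced⁻ cs) (independentOn-reduced cs) (independentOn? cs reduced)
    where open Elimination f p x f[p,x]≢0

  independentOn⇒≤length : ∀ cs {k} (f : Fin k → C → ℚ) → IndependentOn cs f → k ℕ.≤ length cs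
  independentOn⇒≤length []       {zero}  f ind = z≤n
  independentOn⇒≤length []       {suc k} f ind = ⊥-elim (¬independentOn-[] f ind)
  independentOn⇒≤length (x ∷ cs)         f ind with pivot? f x
  ... | inj₂ column≗0 =
    ℕ.m≤n⇒m≤1+n (independentOn⇒≤length cs f (independentOn-∷⁻ f x cs column≗0 ind))
  independentOn⇒≤length (x ∷ cs) {suc k} f ind | inj₁ (p , f[p,x]≢0) =
    s≤s (independentOn⇒≤length cs reduced (independentOn-reduced cs ind))
    where open Elimination f p x f[p,x]≢0

allPairs : ∀ n → List (Fin n × Fin n)
allPairs n = cartesianProduct (allFin n) (allFin n)

entries : ∀ {n d} → (Fin d → Vect n) → Fin d → Fin n × Fin n → ℚ
entries f k (i , j) = f k i j

LinIndep⇒independentOn : ∀ {n d} (f : Fin d → Vect n) → LinIndep f → IndependentOn (allPairs n) (entries f)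
LinIndep⇒independentOn f li c vanish =
  li c (λ i j → vanish (i , j) (∈-cartesianProduct⁺ (∈-allFin i) (∈-allFin j)))

independentOn⇒LinIndep : ∀ {n d} (f : Fin d → Vect n) → IndependentOn (allPairs n) (entries f) → LinIndep f
independentOn⇒LinIndep f ind c vanish = ind c (λ (i , j) _ → vanish i j)

linIndep? : ∀ {n d} (f : Fin d → Vect n) → Dec (LinIndep f)
linIndep? {n} f = map′ (independentOn⇒LinIndep f) (LinIndep⇒independentOn f) (independentOn? (allPairs n) (entries f))

LinIndep⇒≤ : ∀ {n d} (f : Fin d → Vect n) → LinIndep f → d ℕ.≤ length (allPairs n)
LinIndep⇒≤ {n} f li = independentOn⇒≤length (allPairs n) (entries f) (LinIndep⇒independentOn f li)

LinIndep-resp : ∀ {n d} {f g : Fin d → Vect n} → (∀ k i j → f k i j ≡ g k i j) → LinIndep f → LinIndep g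
LinIndep-resp f≗g li c vanish = li c (λ i j → trans (sumF-cong (λ k → cong (c k *_) (f≗g k i j))) (vanish i j))

∃-Fin→Fin? : ∀ {K} d (Q : (Fin d → Fin K) → Set) →
             (∀ {g g′} → (∀ k → g k ≡ g′ k) → Q g → Q g′) → (∀ g → Dec (Q g)) → Dec (∃ Q)
∃-Fin→Fin? d Q resp Q? =
  map′ (λ (t , q) → finToFun t , q) (λ (g , q) → funToFin g , resp (sym ∘ finToFun-funToFin g) q) (any? (Q? ∘ finToFun))

module FiniteRank {n K : ℕ} (P : Vect n → Set) (F : Fin K → Vect n)
                  (Good : Fin K → Set) (good? : ∀ t → Dec (Good t))
                  (good⇒P : ∀ t → Good t → P (F t))
                  (P⇒good : ∀ v → P v → ∃ λ t → Good t × (∀ i j → v i j ≡ F t i j)) where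

  IndependentChoice : ℕ → Set
  IndependentChoice d = ∃ λ (g : Fin d → Fin K) → (∀ k → Good (g k)) × LinIndep (F ∘ g)

  independentChoice? : ∀ d → Dec (IndependentChoice d)
  independentChoice? d = ∃-Fin→Fin? d _
    (λ g≗g′ (good , li) → (λ k → subst Good (g≗g′ k) (good k)) ,
                          LinIndep-resp (λ k i j → cong (λ t → F t i j) (g≗g′ k)) li)
    (λ g → all? (λ k → good? (g k)) ×-dec linIndep? (F ∘ g))

  maximalChoice : ∀ bound →
    ∃ λ d → IndependentChoice d × (∀ e → d ℕ.< e → e ℕ.≤ bound → ¬ IndependentChoice e)
  maximalChoice zero = 0 , ((λ ()) , (λ ()) , (λ _ _ ())) , λ { _ d<e z≤n → λ _ → ℕ.<-irrefl refl d<e }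
  maximalChoice (suc bound) with independentChoice? (suc bound)
  ... | yes choice = suc bound , choice , λ _ d<e e≤d _ → ℕ.<-irrefl refl (ℕ.<-≤-trans d<e e≤d)
  ... | no ¬choice with maximalChoice bound
  ...   | d , choice , maximal = d , choice , above
    where
    above : ∀ e → d ℕ.< e → e ℕ.≤ suc bound → ¬ IndependentChoice e
    above e d<e e≤1+bound with e ℕ.≟ suc bound
    ... | yes refl = ¬choice
    ... | no e≢1+bound = maximal e d<e (ℕ.≤-pred (ℕ.≤∧≢⇒< e≤1+bound e≢1+bound))

  hasDimSpan : ∃ (HasDimSpan P)
  hasDimSpan with maximalChoice (length (allPairs n))
  ... | d , (g , good , li) , maximal =
    d , ((F ∘ g) , (λ k → good⇒P (g k) (good k)) , li) , λ h Ph li-h →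
      let t = λ k → proj₁ (P⇒good (h k) (Ph k))
          li-t = LinIndep-resp (λ k → proj₂ (proj₂ (P⇒good (h k) (Ph k)))) li-h
      in maximal (suc d) ℕ.≤-refl (LinIndep⇒≤ (F ∘ t) li-t)
                 (t , (λ k → proj₁ (proj₂ (P⇒good (h k) (Ph k)))) , li-t)

EntryOf : ∀ {m} → Maybe (Fin m × Fin m) → Vect m → ℚ → Set
EntryOf nothing        u a = a ≡ 0ℚ
EntryOf (just (i , j)) u a = a ≡ u i j

ReadFrom : ∀ {n m} → (Fin n → Fin n → Maybe (Fin m × Fin m)) → Vect m → Vect n → Set
ReadFrom σ u v = ∀ x y → EntryOf (σ x y) u (v x y)

EntryOf-≡ : ∀ {m} (e : Maybe (Fin m × Fin m)) {u : Vect m} {a a′ : ℚ} → a ≡ a′ → EntryOf e u a′ → EntryOf e u a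
EntryOf-≡ nothing  a≡a′ entry = trans a≡a′ entry
EntryOf-≡ (just _) a≡a′ entry = trans a≡a′ entry

LinIndep-readFrom : ∀ {n m d} (σ : Fin n → Fin n → Maybe (Fin m × Fin m))
                    {f : Fin d → Vect n} {g : Fin d → Vect m} →
                    (∀ k → ReadFrom σ (g k) (f k)) → LinIndep f → LinIndep g
LinIndep-readFrom σ {f} {g} read li c vanish = li c (λ x y → entryVanishes x y (σ x y) (λ k → read k x y))
  where
  entryVanishes : ∀ x y e → (∀ k → EntryOf e (g k) (f k x y)) → sumF (λ k → c k * f k x y) ≡ 0ℚ
  entryVanishes x y nothing        entry = sumF-zero (λ k → trans (cong (c k *_) (entry k)) (*-zeroʳ (c k)))
  entryVanishes x y (just (i , j)) entry = trans (sumF-cong (λ k → cong (c k *_) (entry k))) (vanish i j)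

HasDimSpan-transfer : ∀ {n m} (σ : Fin n → Fin n → Maybe (Fin m × Fin m)) (ρ : Fin m → Fin m → Maybe (Fin n × Fin n))
  {P : Vect n → Set} {Q : Vect m → Set} →
  (∀ v → P v → ∃ λ u → Q u × ReadFrom σ u v) →
  (∀ u → Q u → ∃ λ v → P v × ReadFrom ρ v u) →
  ∀ {d} → HasDimSpan P d → HasDimSpan Q d
HasDimSpan-transfer σ ρ P⇒Q Q⇒P ((f , Pf , li-f) , noMore) =
  ((λ k → proj₁ (P⇒Q (f k) (Pf k))) , (λ k → proj₁ (proj₂ (P⇒Q (f k) (Pf k)))) ,
   LinIndep-readFrom σ (λ k → proj₂ (proj₂ (P⇒Q (f k) (Pf k)))) li-f) ,
  λ g Qg li-g → noMore (λ k → proj₁ (Q⇒P (g k) (Qg k))) (λ k → proj₁ (proj₂ (Q⇒P (g k) (Qg k))))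
                       (LinIndep-readFrom ρ (λ k → proj₂ (proj₂ (Q⇒P (g k) (Qg k)))) li-g)

≢⇒xor≡true : ∀ {x y : Bool} → x ≢ y → x xor y ≡ true
≢⇒xor≡true {y = y} x≢y = trans (cong (_xor y) (¬-not x≢y)) (xor-inverseˡ y)

≡⇒xor≡false : ∀ {x y : Bool} → x ≡ y → x xor y ≡ false
≡⇒xor≡false {x} refl = xor-same x

xor≡true⇒≢ : ∀ {x y : Bool} → x xor y ≡ true → x ≢ y
xor≡true⇒≢ {x} x⊕y≡true refl = case trans (sym x⊕y≡true) (xor-same x) of λ ()

xor≡false⇒≡ : ∀ {x y : Bool} → x xor y ≡ false → x ≡ y
xor≡false⇒≡ {x} {y} x⊕y≡false with x ≟ᵇ y
... | yes x≡y = x≡y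
... | no x≢y = case trans (sym x⊕y≡false) (≢⇒xor≡true x≢y) of λ ()

≢∧≢⇒≡ : ∀ {x y z : Bool} → x ≢ z → y ≢ z → x ≡ y
≢∧≢⇒≡ x≢z y≢z = trans (¬-not x≢z) (sym (¬-not y≢z))

cutWeight-cong : ∀ {n} (w : Weight n) {X Y : Subset n} → (∀ i → X i ≡ Y i) → cutWeight w X ≡ cutWeight w Y
cutWeight-cong w X≗Y = sumF-cong λ i → sumF-cong λ j →
  cong₂ (λ x y → if x ∧ not y then w i j else 0ℚ) (X≗Y i) (X≗Y j)

Proper-cong : ∀ {n} {X Y : Subset n} → (∀ i → X i ≡ Y i) → Proper X → Proper Y
Proper-cong X≗Y ((i , Xi) , (j , Xj)) = (i , trans (sym (X≗Y i)) Xi) , (j , trans (sym (X≗Y j)) Xj)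

IsMinCut-cong : ∀ {n} (w : Weight n) {X Y : Subset n} → (∀ i → X i ≡ Y i) → IsMinCut w X → IsMinCut w Y
IsMinCut-cong w X≗Y (proper , minimal) =
  Proper-cong X≗Y proper , λ Z pZ → ≤-trans (≤-reflexive (cutWeight-cong w (sym ∘ X≗Y))) (minimal Z pZ)

chi-cong : ∀ {n} (w : Weight n) {X Y : Subset n} → (∀ i → X i ≡ Y i) → ∀ i j → chi w X i j ≡ chi w Y i j
chi-cong w X≗Y i j = cong₂ (λ x y → if (x xor y) ∧ ⌊ 0ℚ <? w i j ⌋ then 1ℚ else 0ℚ) (X≗Y i) (X≗Y j)

crossWeight : ∀ {n} → Weight n → Subset n → ℚ
crossWeight w X = sumF (λ i → sumF (λ j → if X i xor X j then w i j else 0ℚ))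

module _ {n} {w : Weight n} (wg : IsWeightedGraph w) where

  private
    w-sym = proj₁ wg
    w-nonNeg = proj₂ wg

    cutTerm : Subset n → Fin n → Fin n → ℚ
    cutTerm X i j = if X i ∧ not (X j) then w i j else 0ℚ

    cutTerm-nonNeg : ∀ X i j → 0ℚ ≤ cutTerm X i j
    cutTerm-nonNeg X i j with X i in Xi | X j in Xj
    ... | true  | true  = ≤-refl
    ... | false | _     = ≤-refl
    ... | true  | false = w-nonNeg i j (λ { refl → case trans (sym Xi) Xj of λ () })

  weight≤cutWeight : ∀ X i j → X i ≡ true → X j ≡ false → w i j ≤ cutWeight w X
  weight≤cutWeight X i j Xi Xj = ≤-trans (≤-reflexive w≡term)
    (≤-trans (≤-sumF (cutTerm-nonNeg X i) j) (≤-sumF (λ i′ → sumF-nonNeg (cutTerm-nonNeg X i′)) i))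
    where
    w≡term : w i j ≡ cutTerm X i j
    w≡term rewrite Xi | Xj = refl

  cutWeight≤0⇒¬positive : ∀ X → cutWeight w X ≤ 0ℚ → ∀ i j → X i ≢ X j → ¬ 0ℚ < w i j
  cutWeight≤0⇒¬positive X λ≤0 i j Xi≢Xj 0<w with X i in Xi | X j in Xj
  ... | true  | true  = Xi≢Xj refl
  ... | false | false = Xi≢Xj refl
  ... | true  | false = <-irrefl refl (<-≤-trans 0<w (≤-trans (weight≤cutWeight X i j Xi Xj) λ≤0))
  ... | false | true  = <-irrefl refl
    (<-≤-trans (subst (0ℚ <_) (w-sym i j) 0<w) (≤-trans (weight≤cutWeight X j i Xj Xi) λ≤0))

  chi-zero : ∀ X → cutWeight w X ≤ 0ℚ → ∀ i j → chi w X i j ≡ 0ℚ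
  chi-zero X λ≤0 i j with 0ℚ <? w i j
  ... | no _ rewrite ∧-zeroʳ (X i xor X j) = refl
  ... | yes 0<w with X i ≟ᵇ X j
  ...   | yes Xi≡Xj rewrite Xi≡Xj | xor-same (X j) = refl
  ...   | no Xi≢Xj = ⊥-elim (cutWeight≤0⇒¬positive X λ≤0 i j Xi≢Xj 0<w)

  crossWeight≡cutWeight+cutWeight : ∀ X → crossWeight w X ≡ cutWeight w X + cutWeight w X
  crossWeight≡cutWeight+cutWeight X = begin
    crossWeight w X
      ≡⟨ sumF-cong (λ i → trans (sumF-cong (bothOrientations i)) (sumF-+ (cutTerm X i) (λ j → cutTerm X j i))) ⟩
    sumF (λ i → sumF (cutTerm X i) + sumF (λ j → cutTerm X j i))
      ≡⟨ sumF-+ (λ i → sumF (cutTerm X i)) (λ i → sumF (λ j → cutTerm X j i)) ⟩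
    cutWeight w X + sumF (λ i → sumF (λ j → cutTerm X j i))
      ≡⟨ cong (cutWeight w X +_) (sumF-comm (λ i j → cutTerm X j i)) ⟩
    cutWeight w X + cutWeight w X ∎
    where
    bothOrientations : ∀ i j → (if X i xor X j then w i j else 0ℚ) ≡ cutTerm X i j + cutTerm X j i
    bothOrientations i j with X i | X j
    ... | true  | true  = refl
    ... | false | false = refl
    ... | true  | false = sym (+-identityʳ (w i j))
    ... | false | true  = trans (w-sym i j) (sym (+-identityˡ (w j i)))

-- Separation along a cut

module Separation {n : ℕ} (w : Weight n) (s : Subset n) (b : Bool) {m : ℕ} (φ : Fin m ↔ SepVertex s b) where

  Vᵇ : Set
  Vᵇ = SepVertex s b

  wᵇ : Weight m
  wᵇ = sepGraph w s b φ

  ψ : Fin m → Vᵇ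
  ψ = Inverse.to φ

  ψ⁻¹ : Vᵇ → Fin m
  ψ⁻¹ = Inverse.from φ

  ψ∘ψ⁻¹ : ∀ a → ψ (ψ⁻¹ a) ≡ a
  ψ∘ψ⁻¹ = Inverse.strictlyInverseˡ φ

  ψ⁻¹∘ψ : ∀ i → ψ⁻¹ (ψ i) ≡ i
  ψ⁻¹∘ψ = Inverse.strictlyInverseʳ φ

  new : Vᵇ
  new = inj₂ tt

  shore-irrelevant : ∀ {x} (p q : s x ≡ b) → p ≡ q
  shore-irrelevant = Decidable⇒UIP.≡-irrelevant _≟ᵇ_

  onShore : (Vᵇ → ℚ) → ∀ x → Dec (s x ≡ b) → ℚ
  onShore H x (yes p) = H (inj₁ (x , p))
  onShore H x (no _)  = 0ℚ

  sumᵇ : (Vᵇ → ℚ) → ℚ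
  sumᵇ H = sumF (λ x → onShore H x (s x ≟ᵇ b)) + H new

  private
    atShoreVertex : Vᵇ → Fin n → ℚ → ℚ
    atShoreVertex (inj₁ (x′ , _)) x h with x′ ≟ᶠ x
    ... | yes _ = h
    ... | no _  = 0ℚ
    atShoreVertex (inj₂ _) x h = 0ℚ

    atNew : Vᵇ → ℚ → ℚ
    atNew (inj₁ _) h = 0ℚ
    atNew (inj₂ _) h = h

    split-vertex : ∀ a h → h ≡ sumF (λ x → atShoreVertex a x h) + atNew a h
    split-vertex (inj₁ (x′ , p)) h = sym (begin
      sumF (λ x → atShoreVertex (inj₁ (x′ , p)) x h) + 0ℚ  ≡⟨ +-identityʳ _ ⟩
      sumF (λ x → atShoreVertex (inj₁ (x′ , p)) x h)       ≡⟨ sumF-single x′ _ elsewhere ⟩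
      atShoreVertex (inj₁ (x′ , p)) x′ h                   ≡⟨ atItself ⟩
      h                                                    ∎)
      where
      elsewhere : ∀ x → x ≢ x′ → atShoreVertex (inj₁ (x′ , p)) x h ≡ 0ℚ
      elsewhere x x≢x′ with x′ ≟ᶠ x
      ... | yes x′≡x = ⊥-elim (x≢x′ (sym x′≡x))
      ... | no _     = refl
      atItself : atShoreVertex (inj₁ (x′ , p)) x′ h ≡ h
      atItself with x′ ≟ᶠ x′
      ... | yes _    = refl
      ... | no x′≢x′ = ⊥-elim (x′≢x′ refl)
    split-vertex (inj₂ _) h = sym (trans (cong (_+ h) (sumF-zero {n} (λ _ → refl))) (+-identityˡ h))

    sum-atShoreVertex : ∀ (H : Vᵇ → ℚ) x d → sumF (λ i → atShoreVertex (ψ i) x (H (ψ i))) ≡ onShore H x d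
    sum-atShoreVertex H x (yes p) =
      trans (sumF-single (ψ⁻¹ a) _ (λ i i≢ → elsewhere i (ψ i) refl i≢)) atItself
      where
      a = inj₁ (x , p)
      elsewhere : ∀ i a′ → ψ i ≡ a′ → i ≢ ψ⁻¹ a → atShoreVertex a′ x (H (ψ i)) ≡ 0ℚ
      elsewhere i (inj₁ (x′ , p′)) ψi≡a′ i≢ with x′ ≟ᶠ x
      ... | no _ = refl
      ... | yes refl = ⊥-elim (i≢ (trans (sym (ψ⁻¹∘ψ i))
                         (cong ψ⁻¹ (trans ψi≡a′ (cong (λ q → inj₁ (x , q)) (shore-irrelevant p′ p))))))
      elsewhere i (inj₂ _) _ _ = refl
      atItself : atShoreVertex (ψ (ψ⁻¹ a)) x (H (ψ (ψ⁻¹ a))) ≡ H a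
      atItself rewrite ψ∘ψ⁻¹ a with x ≟ᶠ x
      ... | yes _  = refl
      ... | no x≢x = ⊥-elim (x≢x refl)
    sum-atShoreVertex H x (no s[x]≢b) = sumF-zero (λ i → offShore (ψ i) (H (ψ i)))
      where
      offShore : ∀ a h → atShoreVertex a x h ≡ 0ℚ
      offShore (inj₁ (x′ , p′)) h with x′ ≟ᶠ x
      ... | no _     = refl
      ... | yes refl = ⊥-elim (s[x]≢b p′)
      offShore (inj₂ _) h = refl

    sum-atNew : ∀ (H : Vᵇ → ℚ) → sumF (λ i → atNew (ψ i) (H (ψ i))) ≡ H new
    sum-atNew H = trans (sumF-single (ψ⁻¹ new) _ (λ i i≢ → elsewhere i (ψ i) refl i≢)) atItself
      where
      elsewhere : ∀ i a → ψ i ≡ a → i ≢ ψ⁻¹ new → atNew a (H (ψ i)) ≡ 0ℚ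
      elsewhere i (inj₁ _) _    _  = refl
      elsewhere i (inj₂ _) ψi≡a i≢ = ⊥-elim (i≢ (trans (sym (ψ⁻¹∘ψ i)) (cong ψ⁻¹ ψi≡a)))
      atItself : atNew (ψ (ψ⁻¹ new)) (H (ψ (ψ⁻¹ new))) ≡ H new
      atItself rewrite ψ∘ψ⁻¹ new = refl

  sumF-ψ : ∀ (H : Vᵇ → ℚ) → sumF (H ∘ ψ) ≡ sumᵇ H
  sumF-ψ H = begin
    sumF (H ∘ ψ)
      ≡⟨ sumF-cong (λ i → split-vertex (ψ i) (H (ψ i))) ⟩
    sumF (λ i → sumF (λ x → atShoreVertex (ψ i) x (H (ψ i))) + atNew (ψ i) (H (ψ i)))
      ≡⟨ sumF-+ (λ i → sumF (λ x → atShoreVertex (ψ i) x (H (ψ i)))) (λ i → atNew (ψ i) (H (ψ i))) ⟩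
    sumF (λ i → sumF (λ x → atShoreVertex (ψ i) x (H (ψ i)))) + sumF (λ i → atNew (ψ i) (H (ψ i)))
      ≡⟨ cong₂ _+_ (trans (sumF-comm (λ i x → atShoreVertex (ψ i) x (H (ψ i))))
                          (sumF-cong (λ x → sum-atShoreVertex H x (s x ≟ᵇ b))))
                   (sum-atNew H) ⟩
    sumᵇ H ∎

  lift′ : (Vᵇ → Bool) → ∀ x → Dec (s x ≡ b) → Bool
  lift′ U x (yes p) = U (inj₁ (x , p))
  lift′ U x (no _)  = U new

  lift : (Vᵇ → Bool) → Subset n
  lift U x = lift′ U x (s x ≟ᵇ b)

  module _ (U : Vᵇ → Bool) where

    private
      term : Vᵇ → Vᵇ → ℚ
      term a a′ = if U a ∧ not (U a′) then sepWeight w s b a a′ else 0ℚ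

      termAt : ∀ x y → Dec (s x ≡ b) → Dec (s y ≡ b) → ℚ
      termAt x y dx dy = if lift′ U x dx ∧ not (lift′ U y dy) then w x y else 0ℚ

      fromShore fromOffShore : ∀ x y → Dec (s x ≡ b) → Dec (s y ≡ b) → ℚ
      fromShore    x y (yes p) dy = termAt x y (yes p) dy
      fromShore    x y (no _)  dy = 0ℚ
      fromOffShore x y (yes _) dy = 0ℚ
      fromOffShore x y (no q)  dy = termAt x y (no q) dy

      termAt-split : ∀ x y dx dy → termAt x y dx dy ≡ fromShore x y dx dy + fromOffShore x y dx dy
      termAt-split x y (yes _) dy = sym (+-identityʳ _)
      termAt-split x y (no _)  dy = sym (+-identityˡ _)

      offShore : ∀ {y} → Bool → ℚ → Dec (s y ≡ b) → ℚ
      offShore c q (yes _) = 0ℚ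
      offShore c q (no _)  = if c then q else 0ℚ

      sum-offShore : ∀ c (W : Fin n → ℚ) →
        sumF (λ y → offShore c (W y) (s y ≟ᵇ b)) ≡ (if c then sumF (λ y → if s y xor b then W y else 0ℚ) else 0ℚ)
      sum-offShore true  W = sumF-cong (λ y → term≡ y (s y ≟ᵇ b))
        where
        term≡ : ∀ y (dy : Dec (s y ≡ b)) → offShore true (W y) dy ≡ (if s y xor b then W y else 0ℚ)
        term≡ y (yes s[y]≡b) rewrite ≡⇒xor≡false s[y]≡b = refl
        term≡ y (no s[y]≢b)  rewrite ≢⇒xor≡true s[y]≢b  = refl
      sum-offShore false W = sumF-zero (λ y → term≡ y (s y ≟ᵇ b))
        where
        term≡ : ∀ y (dy : Dec (s y ≡ b)) → offShore false (W y) dy ≡ 0ℚ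
        term≡ y (yes _) = refl
        term≡ y (no _)  = refl

      row-fromShore : ∀ x dx → sumF (λ y → fromShore x y dx (s y ≟ᵇ b)) ≡ onShore (λ a → sumᵇ (term a)) x dx
      row-fromShore x (no _)  = sumF-zero {n} (λ _ → refl)
      row-fromShore x (yes p) = begin
        sumF (λ y → termAt x y (yes p) (s y ≟ᵇ b))
          ≡⟨ sumF-cong (λ y → split y (s y ≟ᵇ b)) ⟩
        sumF (λ y → onShore (term a) y (s y ≟ᵇ b) + offShore c (w x y) (s y ≟ᵇ b))
          ≡⟨ sumF-+ (λ y → onShore (term a) y (s y ≟ᵇ b)) (λ y → offShore c (w x y) (s y ≟ᵇ b)) ⟩
        sumF (λ y → onShore (term a) y (s y ≟ᵇ b)) + sumF (λ y → offShore c (w x y) (s y ≟ᵇ b))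
          ≡⟨ cong (sumF (λ y → onShore (term a) y (s y ≟ᵇ b)) +_) (sum-offShore c (w x)) ⟩
        sumᵇ (term a) ∎
        where
        a = inj₁ (x , p)
        c = U a ∧ not (U new)
        split : ∀ y dy → termAt x y (yes p) dy ≡ onShore (term a) y dy + offShore c (w x y) dy
        split y (yes _) = sym (+-identityʳ _)
        split y (no _)  = sym (+-identityˡ _)

      column-fromOffShore : ∀ y dy → sumF (λ x → fromOffShore x y (s x ≟ᵇ b) dy) ≡ onShore (term new) y dy
      column-fromOffShore y (yes q) = trans (sumF-cong (λ x → split x (s x ≟ᵇ b))) (sum-offShore c (λ x → w x y))
        where
        c = U new ∧ not (U (inj₁ (y , q)))
        split : ∀ x dx → fromOffShore x y dx (yes q) ≡ offShore c (w x y) dx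
        split x (yes _) = refl
        split x (no _)  = refl
      column-fromOffShore y (no _) = sumF-zero (λ x → vanish x (s x ≟ᵇ b))
        where
        vanish : ∀ x dx → fromOffShore x y dx (no _) ≡ 0ℚ
        vanish x (yes _) = refl
        vanish x (no _) with U new
        ... | true  = refl
        ... | false = refl

      term-new-new : term new new ≡ 0ℚ
      term-new-new with U new
      ... | true  = refl
      ... | false = refl

      cutWeight-lift≡sumᵇ : cutWeight w (lift U) ≡ sumᵇ (λ a → sumᵇ (term a))
      cutWeight-lift≡sumᵇ = begin
        sumF (λ x → sumF (λ y → termAt x y (dx x) (dx y)))
          ≡⟨ sumF-cong (λ x → trans (sumF-cong (λ y → termAt-split x y (dx x) (dx y)))
                                    (sumF-+ (λ y → fromShore x y (dx x) (dx y)) (λ y → fromOffShore x y (dx x) (dx y)))) ⟩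
        sumF (λ x → sumF (λ y → fromShore x y (dx x) (dx y)) + sumF (λ y → fromOffShore x y (dx x) (dx y)))
          ≡⟨ sumF-+ (λ x → sumF (λ y → fromShore x y (dx x) (dx y))) (λ x → sumF (λ y → fromOffShore x y (dx x) (dx y))) ⟩
        sumF (λ x → sumF (λ y → fromShore x y (dx x) (dx y))) + sumF (λ x → sumF (λ y → fromOffShore x y (dx x) (dx y)))
          ≡⟨ cong₂ _+_ (sumF-cong (λ x → row-fromShore x (dx x)))
                       (trans (sumF-comm (λ x y → fromOffShore x y (dx x) (dx y)))
                              (sumF-cong (λ y → column-fromOffShore y (dx y)))) ⟩
        sumF (λ x → onShore (λ a → sumᵇ (term a)) x (dx x)) + sumF (λ y → onShore (term new) y (dx y))
          ≡⟨ cong (sumF (λ x → onShore (λ a → sumᵇ (term a)) x (dx x)) +_)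
                  (trans (sym (+-identityʳ _)) (cong (sumF (λ y → onShore (term new) y (dx y)) +_) (sym term-new-new))) ⟩
        sumᵇ (λ a → sumᵇ (term a)) ∎
        where
        dx : ∀ x → Dec (s x ≡ b)
        dx x = s x ≟ᵇ b

    cutWeightᵇ-lift : cutWeight wᵇ (U ∘ ψ) ≡ cutWeight w (lift U)
    cutWeightᵇ-lift = begin
      sumF (λ i → sumF (λ j → term (ψ i) (ψ j)))  ≡⟨ sumF-cong (λ i → sumF-ψ (term (ψ i))) ⟩
      sumF (λ i → sumᵇ (term (ψ i)))              ≡⟨ sumF-ψ (λ a → sumᵇ (term a)) ⟩
      sumᵇ (λ a → sumᵇ (term a))                  ≡⟨ cutWeight-lift≡sumᵇ ⟨
      cutWeight w (lift U)                        ∎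

-- Minimum cuts splitting the far shore

Proper-attains : ∀ {n} {X : Subset n} → Proper X → ∀ c → ∃ λ i → X i ≡ c
Proper-attains (inX , _) true  = inX
Proper-attains (_ , outX) false = outX

WithinZ∪E : ∀ {n} → Weight n → Subset n → Bool → Subset n → Set
WithinZ∪E {n} w s b X =
  ∀ (i j : Fin n) → IsEdge w i j → Separates X i j → Separates s i j ⊎ (s i ≡ b × s j ≡ b)

xor-cancelʳ : ∀ x y c → (x xor c) xor (y xor c) ≡ x xor y
xor-cancelʳ false false false = refl
xor-cancelʳ false false true  = refl
xor-cancelʳ false true  false = refl
xor-cancelʳ false true  true  = refl
xor-cancelʳ true  false false = refl
xor-cancelʳ true  false true  = refl
xor-cancelʳ true  true  false = refl
xor-cancelʳ true  true  true  = refl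

double≤self⇒≤0 : ∀ x → (x + x) + (x + x) ≤ x + x → x ≤ 0ℚ
double≤self⇒≤0 x 4x≤2x with x ≤? 0ℚ
... | yes x≤0 = x≤0
... | no x≰0 = ⊥-elim (<-irrefl (+-identityˡ (x + x)) (<-≤-trans (+-mono-<-≤ 0<2x ≤-refl) 4x≤2x))
  where
  0<2x : 0ℚ < x + x
  0<2x = +-mono-< (≰⇒> x≰0) (≰⇒> x≰0)

-- Used with o i = (i ∉ X_b), d i = (X i differs from the value of X on X_b) and Y = o ∧ ¬d:
-- a pair cut by Z is cut by exactly one of X and Y, and a pair inside X_{1-b} cut by X is cut by
-- Y too but has weight ≤ 0.
splitTerm-≤ : ∀ (oᵢ oⱼ dᵢ dⱼ : Bool) (W : ℚ) → (oᵢ ≡ false → dᵢ ≡ false) → (oⱼ ≡ false → dⱼ ≡ false) →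
  (oᵢ ≡ true → oⱼ ≡ true → dᵢ xor dⱼ ≡ true → W ≤ 0ℚ) →
  (if (oᵢ ∧ not dᵢ) xor (oⱼ ∧ not dⱼ) then W else 0ℚ) + (if dᵢ xor dⱼ then W else 0ℚ)
    ≤ (if oᵢ xor oⱼ then W else 0ℚ)
splitTerm-≤ false false dᵢ dⱼ W onᵢ onⱼ _ rewrite onᵢ refl | onⱼ refl = ≤-refl
splitTerm-≤ false true  dᵢ false W onᵢ _ _ rewrite onᵢ refl = ≤-reflexive (+-identityʳ W)
splitTerm-≤ false true  dᵢ true  W onᵢ _ _ rewrite onᵢ refl = ≤-reflexive (+-identityˡ W)
splitTerm-≤ true  false false dⱼ W _ onⱼ _ rewrite onⱼ refl = ≤-reflexive (+-identityʳ W)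
splitTerm-≤ true  false true  dⱼ W _ onⱼ _ rewrite onⱼ refl = ≤-reflexive (+-identityˡ W)
splitTerm-≤ true  true  false false W _ _ _ = ≤-refl
splitTerm-≤ true  true  false true  W _ _ W≤0 = +-mono-≤ (W≤0 refl refl refl) (W≤0 refl refl refl)
splitTerm-≤ true  true  true  false W _ _ W≤0 = +-mono-≤ (W≤0 refl refl refl) (W≤0 refl refl refl)
splitTerm-≤ true  true  true  true  W _ _ _ = ≤-refl

module SplitOffShore {n : ℕ} {w : Weight n} (wg : IsWeightedGraph w) {s : Subset n}
                     (s-min : IsMinCut w s) (crossless : Crossless w s) (b : Bool)
                     (X : Subset n) (X-min : IsMinCut w X) (within : WithinZ∪E w s b X)
                     (y₀ y₁ : Fin n) (s[y₀]≢b : s y₀ ≢ b) (s[y₁]≢b : s y₁ ≢ b)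
                     (X[y₀]≢X[y₁] : X y₀ ≢ X y₁) where

  private
    attains : ∀ {R : Fin n → Set} p₁ p₂ → R p₁ → R p₂ → X p₁ ≢ X p₂ → ∀ t → ∃ λ i → R i × X i ≡ t
    attains p₁ p₂ Rp₁ Rp₂ X[p₁]≢X[p₂] t with X p₁ ≟ᵇ t
    ... | yes X[p₁]≡t = p₁ , Rp₁ , X[p₁]≡t
    ... | no X[p₁]≢t  = p₂ , Rp₂ , ≢∧≢⇒≡ (X[p₁]≢X[p₂] ∘ sym) (X[p₁]≢t ∘ sym)

  constantOnShore : ∀ x x′ → s x ≡ b → s x′ ≡ b → X x ≡ X x′
  constantOnShore x x′ s[x]≡b s[x′]≡b with X x ≟ᵇ X x′
  ... | yes X[x]≡X[x′] = X[x]≡X[x′]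
  ... | no X[x]≢X[x′] = ⊥-elim (crossless X X-min (region true true , region true false , region false true , region false false))
    where
    region : ∀ S t → ∃ λ i → s i ≡ S × X i ≡ t
    region S t with S ≟ᵇ b
    ... | yes S≡b = attains x x′ (trans s[x]≡b (sym S≡b)) (trans s[x′]≡b (sym S≡b)) X[x]≢X[x′] t
    ... | no S≢b  = attains y₀ y₁ (≢∧≢⇒≡ s[y₀]≢b S≢b) (≢∧≢⇒≡ s[y₁]≢b S≢b) X[y₀]≢X[y₁] t

  private
    onShore : ∃ λ x → s x ≡ b
    onShore = Proper-attains (proj₁ s-min) b

    c : Bool
    c = X (proj₁ onShore)

    X≡c : ∀ x → s x ≡ b → X x ≡ c
    X≡c x s[x]≡b = constantOnShore x (proj₁ onShore) s[x]≡b (proj₂ onShore)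

    Y : Subset n
    Y i = (s i xor b) ∧ not (X i xor c)

    inY : ∀ i → s i ≢ b → X i ≡ c → Y i ≡ true
    inY i s[i]≢b X[i]≡c rewrite ≢⇒xor≡true s[i]≢b | ≡⇒xor≡false X[i]≡c = refl

    outY : ∀ i → X i ≢ c → Y i ≡ false
    outY i X[i]≢c rewrite ≢⇒xor≡true X[i]≢c = ∧-zeroʳ _

    Y-proper : Proper Y
    Y-proper with X y₀ ≟ᵇ c
    ... | yes X[y₀]≡c =
      (y₀ , inY y₀ s[y₀]≢b X[y₀]≡c) , (y₁ , outY y₁ (λ X[y₁]≡c → X[y₀]≢X[y₁] (trans X[y₀]≡c (sym X[y₁]≡c))))
    ... | no X[y₀]≢c =
      (y₁ , inY y₁ s[y₁]≢b (≢∧≢⇒≡ (X[y₀]≢X[y₁] ∘ sym) (X[y₀]≢c ∘ sym))) , (y₀ , outY y₀ X[y₀]≢c)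

    crossTerm : Subset n → Fin n → Fin n → ℚ
    crossTerm Z i j = if Z i xor Z j then w i j else 0ℚ

    inside-offShore : ∀ i j → s i ≢ b → s j ≢ b → X i xor X j ≡ true → w i j ≤ 0ℚ
    inside-offShore i j s[i]≢b s[j]≢b X-separates with i ≟ᶠ j | 0ℚ <? w i j
    ... | yes refl | _ = ⊥-elim (xor≡true⇒≢ {X i} X-separates refl)
    ... | no _     | no ¬0<w = ≮⇒≥ ¬0<w
    ... | no i≢j   | yes 0<w with within i j (i≢j , 0<w) X-separates
    ...   | inj₁ s-separates = ⊥-elim (xor≡true⇒≢ s-separates (≢∧≢⇒≡ s[i]≢b s[j]≢b))
    ...   | inj₂ (s[i]≡b , _) = ⊥-elim (s[i]≢b s[i]≡b)

    crossTerm-≤ : ∀ i j → crossTerm Y i j + crossTerm X i j ≤ crossTerm s i j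
    crossTerm-≤ i j rewrite sym (xor-cancelʳ (s i) (s j) b) | sym (xor-cancelʳ (X i) (X j) c) =
      splitTerm-≤ (s i xor b) (s j xor b) (X i xor c) (X j xor c) (w i j)
        (λ on → ≡⇒xor≡false (X≡c i (xor≡false⇒≡ on))) (λ on → ≡⇒xor≡false (X≡c j (xor≡false⇒≡ on)))
        (λ offᵢ offⱼ d-separates → inside-offShore i j (xor≡true⇒≢ offᵢ) (xor≡true⇒≢ offⱼ)
                                      (trans (sym (xor-cancelʳ (X i) (X j) c)) d-separates))

    crossWeight-≤ : crossWeight w Y + crossWeight w X ≤ crossWeight w s
    crossWeight-≤ = ≤-trans (≤-reflexive (sym (trans (sumF-cong (λ i → sumF-+ (crossTerm Y i) (crossTerm X i)))
                                                     (sumF-+ (λ i → sumF (crossTerm Y i)) (λ i → sumF (crossTerm X i))))))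
                            (sumF-mono-≤ (λ i → sumF-mono-≤ (crossTerm-≤ i)))

  cutWeight≤0 : cutWeight w X ≤ 0ℚ
  cutWeight≤0 = double≤self⇒≤0 λX
    (≤-trans (+-monoˡ-≤ (λX + λX) (+-mono-≤ λX≤λY λX≤λY))
    (≤-trans (≤-reflexive (sym (cong₂ _+_ (doubled Y) (doubled X))))
    (≤-trans crossWeight-≤
    (≤-trans (≤-reflexive (doubled s)) (+-mono-≤ λs≤λX λs≤λX)))))
    where
    λX = cutWeight w X
    λX≤λY = proj₂ X-min Y Y-proper
    λs≤λX = proj₂ s-min X (proj₁ X-min)
    doubled = crossWeight≡cutWeight+cutWeight wg

-- Minimum cuts of G_b versus M_b

cutIndicator : Bool → ℚ → ℚ
cutIndicator separated q = if separated ∧ ⌊ 0ℚ <? q ⌋ then 1ℚ else 0ℚ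

cutIndicator-positive : ∀ c {q q′} → 0ℚ < q → 0ℚ < q′ → cutIndicator c q ≡ cutIndicator c q′
cutIndicator-positive c {q} {q′} 0<q 0<q′ with 0ℚ <? q | 0ℚ <? q′
... | yes _    | yes _     = refl
... | no ¬0<q  | _         = ⊥-elim (¬0<q 0<q)
... | yes _    | no ¬0<q′  = ⊥-elim (¬0<q′ 0<q′)

cutIndicator-nonPositive : ∀ c {q} → ¬ 0ℚ < q → cutIndicator c q ≡ 0ℚ
cutIndicator-nonPositive c {q} ¬0<q with 0ℚ <? q
... | yes 0<q = ⊥-elim (¬0<q 0<q)
... | no _ rewrite ∧-zeroʳ c = refl

module Correspondence {n : ℕ} {w : Weight n} (wg : IsWeightedGraph w) {s : Subset n}
                      (s-min : IsMinCut w s) (b : Bool) {m : ℕ} (φ : Fin m ↔ SepVertex s b) where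

  open Separation w s b φ

  private
    w-nonNeg = proj₂ wg

  offShoreVertex : ∃ λ y → s y ≢ b
  offShoreVertex with Proper-attains (proj₁ s-min) (not b)
  ... | y , s[y]≡¬b = y , λ s[y]≡b → not-¬ refl (trans (sym s[y]≡b) s[y]≡¬b)

  y₀ : Fin n
  y₀ = proj₁ offShoreVertex

  lift-onShore : ∀ U x (p : s x ≡ b) → lift U x ≡ U (inj₁ (x , p))
  lift-onShore U x p with s x ≟ᵇ b
  ... | yes p′ = cong (λ q → U (inj₁ (x , q))) (shore-irrelevant p′ p)
  ... | no s[x]≢b = ⊥-elim (s[x]≢b p)

  lift-offShore : ∀ U x → s x ≢ b → lift U x ≡ U new
  lift-offShore U x s[x]≢b with s x ≟ᵇ b
  ... | yes s[x]≡b = ⊥-elim (s[x]≢b s[x]≡b)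
  ... | no _ = refl

  lift-attains : ∀ U a → ∃ λ x → lift U x ≡ U a
  lift-attains U (inj₁ (x , p)) = x , lift-onShore U x p
  lift-attains U (inj₂ _) = y₀ , lift-offShore U y₀ (proj₂ offShoreVertex)

  Proper-lift⇒ : ∀ U → Proper (lift U) → Proper (U ∘ ψ)
  Proper-lift⇒ U ((x , inside) , (x′ , outside)) = attains x inside , attains x′ outside
    where
    attains : ∀ {t} x → lift U x ≡ t → ∃ λ i → U (ψ i) ≡ t
    attains x lift[x]≡t with s x ≟ᵇ b
    ... | yes p = ψ⁻¹ (inj₁ (x , p)) , trans (cong U (ψ∘ψ⁻¹ _)) lift[x]≡t
    ... | no _  = ψ⁻¹ new , trans (cong U (ψ∘ψ⁻¹ _)) lift[x]≡t

  Proper-lift⇐ : ∀ U → Proper (U ∘ ψ) → Proper (lift U)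
  Proper-lift⇐ U ((i , inside) , (i′ , outside)) = attains (ψ i) inside , attains (ψ i′) outside
    where
    attains : ∀ {t} a → U a ≡ t → ∃ λ x → lift U x ≡ t
    attains a U[a]≡t = proj₁ (lift-attains U a) , trans (proj₂ (lift-attains U a)) U[a]≡t

  shoreCut : Vᵇ → Bool
  shoreCut (inj₁ _) = b
  shoreCut (inj₂ _) = not b

  lift-shoreCut : ∀ x → lift shoreCut x ≡ s x
  lift-shoreCut x with s x ≟ᵇ b
  ... | yes s[x]≡b = sym s[x]≡b
  ... | no s[x]≢b  = sym (¬-not s[x]≢b)

  IsMinCut-lift⇒ : ∀ U → IsMinCut w (lift U) → IsMinCut wᵇ (U ∘ ψ)
  IsMinCut-lift⇒ U (proper , minimal) = Proper-lift⇒ U proper , λ Y Y-proper →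
    let V = Y ∘ ψ⁻¹
        V∘ψ≗Y : ∀ i → V (ψ i) ≡ Y i
        V∘ψ≗Y i = cong Y (ψ⁻¹∘ψ i)
    in ≤-trans (≤-reflexive (cutWeightᵇ-lift U))
       (≤-trans (minimal (lift V) (Proper-lift⇐ V (Proper-cong (sym ∘ V∘ψ≗Y) Y-proper)))
       (≤-reflexive (trans (sym (cutWeightᵇ-lift V)) (cutWeight-cong wᵇ V∘ψ≗Y))))

  IsMinCut-lift⇐ : ∀ U → IsMinCut wᵇ (U ∘ ψ) → IsMinCut w (lift U)
  IsMinCut-lift⇐ U (proper , minimal) = Proper-lift⇐ U proper , λ Y Y-proper →
    ≤-trans (≤-reflexive (sym (cutWeightᵇ-lift U)))
    (≤-trans (minimal (shoreCut ∘ ψ) shoreCut-proper)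
    (≤-trans (≤-reflexive (trans (cutWeightᵇ-lift shoreCut) (cutWeight-cong w lift-shoreCut)))
             (proj₂ s-min Y Y-proper)))
    where
    shoreCut-proper : Proper (shoreCut ∘ ψ)
    shoreCut-proper = Proper-lift⇒ shoreCut (Proper-cong (sym ∘ lift-shoreCut) (proj₁ s-min))

  lift-withinZ∪E : ∀ U → WithinZ∪E w s b (lift U)
  lift-withinZ∪E U i j _ lift-separates with s i ≟ᵇ b | s j ≟ᵇ b
  ... | yes s[i]≡b | yes s[j]≡b = inj₂ (s[i]≡b , s[j]≡b)
  ... | yes s[i]≡b | no s[j]≢b  = inj₁ (≢⇒xor≡true (λ s[i]≡s[j] → s[j]≢b (trans (sym s[i]≡s[j]) s[i]≡b)))
  ... | no s[i]≢b  | yes s[j]≡b = inj₁ (≢⇒xor≡true (λ s[i]≡s[j] → s[i]≢b (trans s[i]≡s[j] s[j]≡b)))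
  ... | no _       | no _       = ⊥-elim (xor≡true⇒≢ {U new} lift-separates refl)

  offShoreSum : (Fin n → ℚ) → ℚ
  offShoreSum W = sumF (λ y → if s y xor b then W y else 0ℚ)

  offShoreSum-positive : ∀ W → (∀ y → s y ≢ b → 0ℚ ≤ W y) → ∀ y → s y ≢ b → 0ℚ < W y → 0ℚ < offShoreSum W
  offShoreSum-positive W 0≤W y s[y]≢b 0<W = <-≤-trans 0<W (≤-trans (≤-reflexive W≡term) (≤-sumF term-nonNeg y))
    where
    W≡term : W y ≡ (if s y xor b then W y else 0ℚ)
    W≡term rewrite ≢⇒xor≡true s[y]≢b = refl
    term-nonNeg : ∀ y′ → 0ℚ ≤ (if s y′ xor b then W y′ else 0ℚ)
    term-nonNeg y′ with s y′ ≟ᵇ b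
    ... | yes s[y′]≡b rewrite ≡⇒xor≡false s[y′]≡b = ≤-refl
    ... | no s[y′]≢b  rewrite ≢⇒xor≡true s[y′]≢b  = 0≤W y′ s[y′]≢b

  offShoreSum-nonPositive : ∀ W → (∀ y → s y ≢ b → ¬ 0ℚ < W y) → ¬ 0ℚ < offShoreSum W
  offShoreSum-nonPositive W ¬0<W 0<sum = <-irrefl refl (<-≤-trans 0<sum (sumF-nonPos term-nonPos))
    where
    term-nonPos : ∀ y → (if s y xor b then W y else 0ℚ) ≤ 0ℚ
    term-nonPos y with s y ≟ᵇ b
    ... | yes s[y]≡b rewrite ≡⇒xor≡false s[y]≡b = ≤-refl
    ... | no s[y]≢b  rewrite ≢⇒xor≡true s[y]≢b  = ≮⇒≥ (¬0<W y s[y]≢b)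

  private
    row-nonNeg : ∀ {x} → s x ≡ b → ∀ y → s y ≢ b → 0ℚ ≤ w x y
    row-nonNeg {x} s[x]≡b y s[y]≢b = w-nonNeg x y (λ { refl → s[y]≢b s[x]≡b })

    column-nonNeg : ∀ {y} → s y ≡ b → ∀ x → s x ≢ b → 0ℚ ≤ w x y
    column-nonNeg {y} s[y]≡b x s[x]≢b = w-nonNeg x y (λ { refl → s[x]≢b s[y]≡b })

  PositiveOffShore : (Fin n → ℚ) → Set
  PositiveOffShore W = ∃ λ y → s y ≢ b × 0ℚ < W y

  positiveOffShore? : ∀ W → Dec (PositiveOffShore W)
  positiveOffShore? W = any? (λ y → ¬? (s y ≟ᵇ b) ×-dec (0ℚ <? W y))

  readVia : (Fin n → Fin n × Fin n) → ∀ {W} → Dec (PositiveOffShore W) → Maybe (Fin n × Fin n)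
  readVia pair (yes (y , _)) = just (pair y)
  readVia pair (no _)        = nothing

  ρᵇ : Vᵇ → Vᵇ → Maybe (Fin n × Fin n)
  ρᵇ (inj₁ (x , _)) (inj₁ (y , _)) = just (x , y)
  ρᵇ (inj₁ (x , _)) (inj₂ _)       = readVia (x ,_) (positiveOffShore? (w x))
  ρᵇ (inj₂ _)       (inj₁ (y , _)) = readVia (_, y) (positiveOffShore? (λ x → w x y))
  ρᵇ (inj₂ _)       (inj₂ _)       = nothing

  ρ : Fin m → Fin m → Maybe (Fin n × Fin n)
  ρ i j = ρᵇ (ψ i) (ψ j)

  chiᵇ-readFrom : ∀ U → ReadFrom ρ (chi w (lift U)) (chi wᵇ (U ∘ ψ))
  chiᵇ-readFrom U i j = entry (ψ i) (ψ j)
    where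
    entry : ∀ a a′ → EntryOf (ρᵇ a a′) (chi w (lift U)) (cutIndicator (U a xor U a′) (sepWeight w s b a a′))
    entry (inj₁ (x , p)) (inj₁ (y , q)) =
      cong (λ c → cutIndicator c (w x y)) (sym (cong₂ _xor_ (lift-onShore U x p) (lift-onShore U y q)))
    entry (inj₁ (x , p)) (inj₂ _) with positiveOffShore? (w x)
    ... | yes (y , s[y]≢b , 0<w) =
      trans (cutIndicator-positive _ (offShoreSum-positive (w x) (row-nonNeg p) y s[y]≢b 0<w) 0<w)
            (cong (λ c → cutIndicator c (w x y)) (sym (cong₂ _xor_ (lift-onShore U x p) (lift-offShore U y s[y]≢b))))
    ... | no none = cutIndicator-nonPositive _ (offShoreSum-nonPositive (w x) (λ y s[y]≢b 0<w → none (y , s[y]≢b , 0<w)))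
    entry (inj₂ _) (inj₁ (y , q)) with positiveOffShore? (λ x → w x y)
    ... | yes (x , s[x]≢b , 0<w) =
      trans (cutIndicator-positive _ (offShoreSum-positive (λ x → w x y) (column-nonNeg q) x s[x]≢b 0<w) 0<w)
            (cong (λ c → cutIndicator c (w x y)) (sym (cong₂ _xor_ (lift-offShore U x s[x]≢b) (lift-onShore U y q))))
    ... | no none = cutIndicator-nonPositive _ (offShoreSum-nonPositive (λ x → w x y) (λ x s[x]≢b 0<w → none (x , s[x]≢b , 0<w)))
    entry (inj₂ _) (inj₂ _) = cutIndicator-nonPositive _ (<-irrefl refl)

  σ′ : ∀ x y → Dec (s x ≡ b) → Dec (s y ≡ b) → Dec (0ℚ < w x y) → Maybe (Fin m × Fin m)
  σ′ x y (yes p) (yes q) _       = just (ψ⁻¹ (inj₁ (x , p)) , ψ⁻¹ (inj₁ (y , q)))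
  σ′ x y (yes p) (no _)  (yes _) = just (ψ⁻¹ (inj₁ (x , p)) , ψ⁻¹ new)
  σ′ x y (yes _) (no _)  (no _)  = nothing
  σ′ x y (no _)  (yes q) (yes _) = just (ψ⁻¹ new , ψ⁻¹ (inj₁ (y , q)))
  σ′ x y (no _)  (yes _) (no _)  = nothing
  σ′ x y (no _)  (no _)  _       = nothing

  σ : Fin n → Fin n → Maybe (Fin m × Fin m)
  σ x y = σ′ x y (s x ≟ᵇ b) (s y ≟ᵇ b) (0ℚ <? w x y)

  chiᵇ-ψ⁻¹ : ∀ U a a′ → chi wᵇ (U ∘ ψ) (ψ⁻¹ a) (ψ⁻¹ a′) ≡ cutIndicator (U a xor U a′) (sepWeight w s b a a′)
  chiᵇ-ψ⁻¹ U a a′ rewrite ψ∘ψ⁻¹ a | ψ∘ψ⁻¹ a′ = refl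

  chi-lift-readFrom : ∀ U → ReadFrom σ (chi wᵇ (U ∘ ψ)) (chi w (lift U))
  chi-lift-readFrom U x y = entry (s x ≟ᵇ b) (s y ≟ᵇ b) (0ℚ <? w x y)
    where
    entry : ∀ dx dy d → EntryOf (σ′ x y dx dy d) (chi wᵇ (U ∘ ψ)) (cutIndicator (lift U x xor lift U y) (w x y))
    entry (yes p) (yes q) _ =
      trans (cong (λ c → cutIndicator c (w x y)) (cong₂ _xor_ (lift-onShore U x p) (lift-onShore U y q)))
            (sym (chiᵇ-ψ⁻¹ U (inj₁ (x , p)) (inj₁ (y , q))))
    entry (yes p) (no s[y]≢b) (yes 0<w) =
      trans (cong (λ c → cutIndicator c (w x y)) (cong₂ _xor_ (lift-onShore U x p) (lift-offShore U y s[y]≢b)))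
      (trans (cutIndicator-positive _ 0<w (offShoreSum-positive (w x) (row-nonNeg p) y s[y]≢b 0<w))
             (sym (chiᵇ-ψ⁻¹ U (inj₁ (x , p)) new)))
    entry (yes _) (no _) (no ¬0<w) = cutIndicator-nonPositive _ ¬0<w
    entry (no s[x]≢b) (yes q) (yes 0<w) =
      trans (cong (λ c → cutIndicator c (w x y)) (cong₂ _xor_ (lift-offShore U x s[x]≢b) (lift-onShore U y q)))
      (trans (cutIndicator-positive _ 0<w
               (offShoreSum-positive (λ x′ → w x′ y) (column-nonNeg q) x s[x]≢b 0<w))
             (sym (chiᵇ-ψ⁻¹ U new (inj₁ (y , q)))))
    entry (no _) (yes _) (no ¬0<w) = cutIndicator-nonPositive _ ¬0<w
    entry (no s[x]≢b) (no s[y]≢b) _ =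
      cong (λ c → cutIndicator c (w x y)) (≡⇒xor≡false (trans (lift-offShore U x s[x]≢b) (sym (lift-offShore U y s[y]≢b))))

  restrict : Subset n → Vᵇ → Bool
  restrict X (inj₁ (x , _)) = X x
  restrict X (inj₂ _)       = X y₀

  lift-restrict : ∀ X → (∀ y → s y ≡ b ⊎ X y ≡ X y₀) → ∀ x → lift (restrict X) x ≡ X x
  lift-restrict X constantOffShore x with s x ≟ᵇ b | constantOffShore x
  ... | yes _     | _ = refl
  ... | no s[x]≢b | inj₁ s[x]≡b = ⊥-elim (s[x]≢b s[x]≡b)
  ... | no _      | inj₂ X[x]≡X[y₀] = sym X[x]≡X[y₀]

  representative : Crossless w s → ∀ X → IsMinCut w X → WithinZ∪E w s b X →
                   ∃ λ U → IsMinCut w (lift U) × (∀ i j → chi w X i j ≡ chi w (lift U) i j)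
  representative crossless X X-min within with all? (λ y → (s y ≟ᵇ b) ⊎-dec (X y ≟ᵇ X y₀))
  ... | yes constantOffShore =
    restrict X , IsMinCut-cong w (sym ∘ lift-restrict X constantOffShore) X-min ,
    λ i j → sym (chi-cong w (lift-restrict X constantOffShore) i j)
  ... | no notConstant with ¬∀⟶∃¬ n _ (λ y → (s y ≟ᵇ b) ⊎-dec (X y ≟ᵇ X y₀)) notConstant
  ...   | y₁ , y₁-differs =
    shoreCut , IsMinCut-cong w (sym ∘ lift-shoreCut) s-min ,
    λ i j → trans (chi-zero wg X λX≤0 i j) (sym (trans (chi-cong w lift-shoreCut i j) (chi-zero wg s λs≤0 i j)))
    where
    λX≤0 : cutWeight w X ≤ 0ℚ
    λX≤0 = SplitOffShore.cutWeight≤0 wg s-min crossless b X X-min within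
             y₀ y₁ (proj₂ offShoreVertex) (y₁-differs ∘ inj₁) (λ e → y₁-differs (inj₂ (sym e)))
    λs≤0 : cutWeight w s ≤ 0ℚ
    λs≤0 = ≤-trans (proj₂ s-min X (proj₁ X-min)) λX≤0

  Mb⇒minCutᵇ : Crossless w s → ∀ v → MbVec w s b v → ∃ λ u → MinCutVec wᵇ u × ReadFrom σ u v
  Mb⇒minCutᵇ crossless v (X , X-min , within , v≗chi) with representative crossless X X-min within
  ... | U , lift-min , chi≗chi-lift =
    chi wᵇ (U ∘ ψ) , (U ∘ ψ , IsMinCut-lift⇒ U lift-min , λ _ _ → refl) ,
    λ x y → EntryOf-≡ (σ x y) (trans (v≗chi x y) (chi≗chi-lift x y)) (chi-lift-readFrom U x y)

  minCutᵇ⇒Mb : ∀ u → MinCutVec wᵇ u → ∃ λ v → MbVec w s b v × ReadFrom ρ v u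
  minCutᵇ⇒Mb u (U′ , U′-min , u≗chi) =
    chi w (lift U) ,
    (lift U , IsMinCut-lift⇐ U (IsMinCut-cong wᵇ (sym ∘ U∘ψ≗U′) U′-min) , lift-withinZ∪E U , λ _ _ → refl) ,
    λ i j → EntryOf-≡ (ρ i j) (trans (u≗chi i j) (sym (chi-cong wᵇ U∘ψ≗U′ i j))) (chiᵇ-readFrom U i j)
    where
    U = U′ ∘ ψ⁻¹
    U∘ψ≗U′ : ∀ i → U (ψ i) ≡ U′ i
    U∘ψ≗U′ i = cong U′ (ψ⁻¹∘ψ i)

subsetAt : ∀ {n} → Fin (2 ^ n) → Subset n
subsetAt t = Inverse.to 2↔Bool ∘ finToFun t

indexOf : ∀ {n} → Subset n → Fin (2 ^ n)
indexOf X = funToFin (Inverse.from 2↔Bool ∘ X)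

subsetAt-indexOf : ∀ {n} (X : Subset n) i → subsetAt (indexOf X) i ≡ X i
subsetAt-indexOf X i =
  trans (cong (Inverse.to 2↔Bool) (finToFun-funToFin _ i)) (Inverse.strictlyInverseˡ 2↔Bool (X i))

∀-Subset? : ∀ {n} {Q : Subset n → Set} → (∀ {X Y} → (∀ i → X i ≡ Y i) → Q X → Q Y) →
            (∀ X → Dec (Q X)) → Dec (∀ X → Q X)
∀-Subset? resp Q? =
  map′ (λ ∀Q X → resp (subsetAt-indexOf X) (∀Q (indexOf X))) (λ ∀Q t → ∀Q (subsetAt t)) (all? (Q? ∘ subsetAt))

Proper? : ∀ {n} (X : Subset n) → Dec (Proper X)
Proper? X = any? (λ i → X i ≟ᵇ true) ×-dec any? (λ j → X j ≟ᵇ false)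

IsMinCut? : ∀ {n} (w : Weight n) (X : Subset n) → Dec (IsMinCut w X)
IsMinCut? w X = Proper? X ×-dec ∀-Subset?
  (λ X≗Y bound Y-proper → ≤-trans (bound (Proper-cong (sym ∘ X≗Y) Y-proper)) (≤-reflexive (cutWeight-cong w X≗Y)))
  (λ Y → Proper? Y →-dec (cutWeight w X ≤? cutWeight w Y))

WithinZ∪E? : ∀ {n} (w : Weight n) s b (X : Subset n) → Dec (WithinZ∪E w s b X)
WithinZ∪E? w s b X = all? λ i → all? λ j →
  (¬? (i ≟ᶠ j) ×-dec (0ℚ <? w i j)) →-dec ((X i xor X j ≟ᵇ true) →-dec
    ((s i xor s j ≟ᵇ true) ⊎-dec ((s i ≟ᵇ b) ×-dec (s j ≟ᵇ b))))

WithinZ∪E-cong : ∀ {n} (w : Weight n) s b {X Y : Subset n} → (∀ i → X i ≡ Y i) → WithinZ∪E w s b X → WithinZ∪E w s b Y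
WithinZ∪E-cong w s b X≗Y within i j edge Y-separates = within i j edge (trans (cong₂ _xor_ (X≗Y i) (X≗Y j)) Y-separates)

Mb-hasDimSpan : ∀ {n} (w : Weight n) s b → ∃ (HasDimSpan (MbVec w s b))
Mb-hasDimSpan {n} w s b = FiniteRank.hasDimSpan (MbVec w s b) (chi w ∘ subsetAt) Good good? Good⇒Mb Mb⇒Good
  where
  Good : Fin (2 ^ n) → Set
  Good t = IsMinCut w (subsetAt t) × WithinZ∪E w s b (subsetAt t)

  good? : ∀ t → Dec (Good t)
  good? t = IsMinCut? w (subsetAt t) ×-dec WithinZ∪E? w s b (subsetAt t)

  Good⇒Mb : ∀ t → Good t → MbVec w s b (chi w (subsetAt t))
  Good⇒Mb t (min , within) = subsetAt t , min , within , λ _ _ → refl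

  Mb⇒Good : ∀ v → MbVec w s b v → ∃ λ t → Good t × (∀ i j → v i j ≡ chi w (subsetAt t) i j)
  Mb⇒Good v (X , min , within , v≗chi) =
    indexOf X ,
    (IsMinCut-cong w X≗ min , WithinZ∪E-cong w s b X≗ within) ,
    λ i j → trans (v≗chi i j) (chi-cong w X≗ i j)
    where
    X≗ : ∀ i → X i ≡ subsetAt (indexOf X) i
    X≗ i = sym (subsetAt-indexOf X i)

lemma6p3 : (n : ℕ) (w : Weight n) → IsWeightedGraph w →
           (s : Subset n) → IsMinCut w s → Crossless w s → NonStar s →
           (b : Bool) (m : ℕ) (φ : Fin m ↔ SepVertex s b) →
           ∃ λ (d : ℕ) → HasDimSpan (MbVec w s b) d × CdimIs (sepGraph w s b φ) d
lemma6p3 n w wg s s-min crossless _ b m φ =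
  let d , dimMb = Mb-hasDimSpan w s b
  in d , dimMb , HasDimSpan-transfer σ ρ (Mb⇒minCutᵇ crossless) minCutᵇ⇒Mb dimMb
  where open Correspondence wg s-min b φ
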